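{- Let $\Gamma=(V,E)$ be a simple oriented graph. If $u,v\in F(V)$ are normal forms of the same element of $\mathbf{HK}_\Gamma$ (i.e. $\pi(u)=\pi(v)$), then $u\sim v$. In particular, when $\Gamma=\Gamma_n$, every element of $\mathbf{HK}_{\Gamma_n}$ has a unique normal form.
   Context: A simple oriented graph $\Gamma=(V,E)$ is a directed graph with vertex set $V$ and arrow set $E\subseteq V\times V$ having no self-loops and no oriented cycles of length $2$; write $a\to b$ for $(a,b)\in E$. The Hecke-Kiselman monoid $\mathbf{HK}_\Gamma$ is generated by $V$ subject to: $a^2=a$ for all $a\in V$; $aba=bab=ab$ whenever $a\to b$; $ab=ba$ whenever neither $a\to b$ nor $b\to a$. $F(V)$ is the free monoid on $V$ and $\pi:F(V)\to\mathbf{HK}_\Gamma$ the canonical projection. Elementary cancellations: for $w_1,w_2,u\in F(V)$, $a\in V$, $w_1auaw_2\to w_1auw_2$ if no letter of $u$ has an arrow to $a$, and $w_1auaw_2\to w_1uaw_2$ if no letter of $u$ has an arrow from $a$. A word is a normal form if no elementary cancellation can be performed on it. The equivalence $\sim$ on $F(V)$ is generated by $w_1abw_2\sim w_1baw_2$ for letters $a,b$ with neither $a\to b$ nor $b\to a$. $\Gamma_n$ denotes the graph with vertex set $\{1,\dots,n\}$ and an arrow $i\to j$ exactly when $i<j$. -}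

module Defs where

open import Data.Nat using (ℕ)
open import Data.Bool using (Bool; T)
open import Data.Fin using (Fin; toℕ)
open import Data.Nat using (_<ᵇ_)
open import Data.List using (List; []; _∷_; _++_)
open import Data.List.Relation.Unary.All using (All)
open import Data.Product using (_×_)
open import Relation.Nullary using (¬_)

Graph : ℕ → Set
Graph n = Fin n → Fin n → Bool

module _ {n : ℕ} (Γ : Graph n) where

  Arrow : Fin n → Fin n → Set
  Arrow a b = T (Γ a b)

  IsSimpleOriented : Set
  IsSimpleOriented = (∀ a → ¬ Arrow a a) × (∀ a b → Arrow a b → ¬ Arrow b a)

  Word : Set
  Word = List (Fin n)

  data Rel : Word → Word → Set where
    idem  : ∀ a → Rel (a ∷ a ∷ []) (a ∷ [])
    arr₁  : ∀ a b → Arrow a b → Rel (a ∷ b ∷ a ∷ []) (a ∷ b ∷ [])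
    arr₂  : ∀ a b → Arrow a b → Rel (b ∷ a ∷ b ∷ []) (a ∷ b ∷ [])
    comm  : ∀ a b → ¬ Arrow a b → ¬ Arrow b a → Rel (a ∷ b ∷ []) (b ∷ a ∷ [])

  -- The congruence on F(V) generated by Rel; π u ≡ π v in HK_Γ iff u ≈HK v.
  data _≈HK_ : Word → Word → Set where
    step  : ∀ w₁ w₂ {x y} → Rel x y → (w₁ ++ x ++ w₂) ≈HK (w₁ ++ y ++ w₂)
    refl  : ∀ {u} → u ≈HK u
    sym   : ∀ {u v} → u ≈HK v → v ≈HK u
    trans : ∀ {u v w} → u ≈HK v → v ≈HK w → u ≈HK w

  data _⟶_ : Word → Word → Set where
    cancelR : ∀ w₁ w₂ a u → All (λ x → ¬ Arrow x a) u →
              (w₁ ++ a ∷ u ++ a ∷ w₂) ⟶ (w₁ ++ a ∷ u ++ w₂)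
    cancelL : ∀ w₁ w₂ a u → All (λ x → ¬ Arrow a x) u →
              (w₁ ++ a ∷ u ++ a ∷ w₂) ⟶ (w₁ ++ u ++ a ∷ w₂)

  IsNormalForm : Word → Set
  IsNormalForm w = ∀ w' → ¬ (w ⟶ w')

  data _∼_ : Word → Word → Set where
    swap  : ∀ w₁ w₂ a b → ¬ Arrow a b → ¬ Arrow b a →
            (w₁ ++ a ∷ b ∷ w₂) ∼ (w₁ ++ b ∷ a ∷ w₂)
    refl  : ∀ {u} → u ∼ u
    sym   : ∀ {u v} → u ∼ v → v ∼ u
    trans : ∀ {u v w} → u ∼ v → v ∼ w → u ∼ w

Γₙ : (n : ℕ) → Graph n
Γₙ n i j = toℕ i <ᵇ toℕ j

module Submission where

-- Elementary cancellations shorten words and are valid in HK_Γ, and every defining relation of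
-- HK_Γ is either an elementary cancellation or a swap generating ∼ (asymmetry of Γ makes aba → ab
-- and bab → ab cancellations).  The cancellation system is locally confluent modulo ∼, and every
-- swap is a simulation for it; Newman's lemma modulo ∼ then shows that all normal forms of a word
-- are ∼-equivalent, so the ∼-class of the normal forms of w depends only on π(w).  In Γₙ any two
-- distinct vertices are joined by an arrow, so ∼ is equality there.
--
-- To compare two cancellations of one word, letters are marked live or dead and a cancellation
-- kills a position, so positions are never shifted.  The two sides w₁bcw₂ and w₁cbw₂ of a swap
-- are the two ways of killing one c in the marked word w₁cbcw₂, which lets a cancellation on one
-- side be transported to the other.

open import Defs
open import Data.Bool using (Bool; true; false)
open import Data.Empty using (⊥-elim)
open import Data.Fin as Fin using (Fin; toℕ)
open import Data.Fin.Properties using (toℕ-injective)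
open import Data.List using (List; []; _∷_; _++_; length)
open import Data.List.Membership.Propositional using (_∈_)
open import Data.List.Properties using (++-assoc; ++-identityʳ; ∷-injective)
open import Data.List.Relation.Unary.All as All using (All; []; _∷_)
open import Data.List.Relation.Unary.Any using (here; there)
open import Data.List.Relation.Unary.First as First using (First; [_]; _∷_) renaming (_++_∷_ to firstView)
open import Data.List.Relation.Unary.First.Properties using (toView; fromView)
open import Data.Maybe using (Maybe; just; nothing)
open import Data.Nat using (ℕ; zero; suc; _+_; _<_; _≤_; _≟_; z≤n; s≤s)
open import Data.Nat.Properties
  using (+-identityʳ; +-suc; m≤n+m; +-monoˡ-<; +-cancelʳ-<; <-≤-trans; ≤-<-trans; ≤-pred; <-trans; <-cmp;
         <-asym; <⇒≢; >⇒≢; <⇒≤; ≤-refl; n≮0; <⇒<ᵇ; <ᵇ⇒<; ≤⇒≯; ≤-antisym; n<1+n; ≤∧≢⇒<)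
open import Data.Sum as Sum using (_⊎_; inj₁; inj₂)
open import Function using (_on_)
open import Data.Nat.Induction using (<-wellFounded)
open import Induction.WellFounded using (Acc; acc; WellFounded)
open import Relation.Binary using (tri<; tri≈; tri>)
import Relation.Binary.Construct.On as On
open import Relation.Binary.Construct.Closure.ReflexiveTransitive using (Star; ε; _◅_; _◅◅_)
open import Data.Product as Product using (_×_; _,_; proj₁; proj₂; ∃-syntax)
open import Relation.Binary.PropositionalEquality
  using (_≡_; _≢_; refl; cong; cong₂; subst; subst₂; ≢-sym)
import Relation.Binary.PropositionalEquality as ≡
open import Relation.Nullary using (¬_; Dec; yes; no)
open import Relation.Nullary.Decidable using (map′; _⊎-dec_; T?; ¬?)

<⇒≡suc+ : ∀ {p q} → p < q → ∃[ j ] q ≡ suc j + p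
<⇒≡suc+ {zero}  {suc q} _ = q , cong suc (≡.sym (+-identityʳ q))
<⇒≡suc+ {suc p} {suc q} (s≤s p<q) with <⇒≡suc+ p<q
... | j , refl = j , cong suc (≡.sym (+-suc j p))

module _ {X : Set} where

  at : List X → ℕ → Maybe X
  at []       _       = nothing
  at (x ∷ xs) zero    = just x
  at (x ∷ xs) (suc k) = at xs k

  at-++ʳ : ∀ (A B : List X) k → at (A ++ B) (k + length A) ≡ at B k
  at-++ʳ []      B k rewrite +-identityʳ k          = refl
  at-++ʳ (_ ∷ A) B k rewrite +-suc k (length A) = at-++ʳ A B k

  at-++ˡ : ∀ (A B : List X) {j} → j < length A → at (A ++ B) j ≡ at A j
  at-++ˡ (_ ∷ A) B {zero}  _         = refl
  at-++ˡ (_ ∷ A) B {suc j} (s≤s j<) = at-++ˡ A B j<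

  at⇒<length : ∀ (A : List X) j {x} → at A j ≡ just x → j < length A
  at⇒<length (_ ∷ A) zero    _  = s≤s z≤n
  at⇒<length (_ ∷ A) (suc j) eq = s≤s (at⇒<length A j eq)

  at⇒split : ∀ (xs : List X) p {x} → at xs p ≡ just x →
             ∃[ A ] ∃[ B ] (xs ≡ A ++ x ∷ B × length A ≡ p)
  at⇒split (_ ∷ xs) zero    refl = [] , xs , refl , refl
  at⇒split (y ∷ xs) (suc p) eq with at⇒split xs p eq
  ... | A , B , refl , refl = y ∷ A , B , refl , refl

  at⇒split₂ : ∀ (xs : List X) {p q x y} → p < q → at xs p ≡ just x → at xs q ≡ just y →
              ∃[ A ] ∃[ Q ] ∃[ S ]
                (xs ≡ A ++ x ∷ Q ++ y ∷ S × length A ≡ p × suc (length Q) + length A ≡ q)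
  at⇒split₂ xs {p} {q} {x} p<q atp atq with at⇒split xs p atp
  ... | A , B , refl , refl with <⇒≡suc+ p<q
  ... | j , refl with at⇒split B j (≡.trans (≡.sym (at-++ʳ A (x ∷ B) (suc j))) atq)
  ... | Q , S , refl , refl = A , Q , S , refl , refl , refl

  at⇒split₃ : ∀ (xs : List X) p {x y z} →
              at xs p ≡ just x → at xs (suc p) ≡ just y → at xs (suc (suc p)) ≡ just z →
              ∃[ A ] ∃[ S ] (xs ≡ A ++ x ∷ y ∷ z ∷ S × length A ≡ p)
  at⇒split₃ []                zero    ()
  at⇒split₃ (_ ∷ [])          zero    _    ()
  at⇒split₃ (_ ∷ _ ∷ [])      zero    _    _    ()
  at⇒split₃ (_ ∷ _ ∷ _ ∷ S)   zero    refl refl refl = [] , S , refl , refl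
  at⇒split₃ []                (suc p) ()
  at⇒split₃ (w ∷ xs)          (suc p) atx  aty  atz with at⇒split₃ xs p atx aty atz
  ... | A , S , refl , refl = w ∷ A , S , refl , refl

  ++-assoc-middle : ∀ (p w₁ x w₂ q : List X) → p ++ (w₁ ++ x ++ w₂) ++ q ≡ (p ++ w₁) ++ x ++ w₂ ++ q
  ++-assoc-middle p w₁ x w₂ q = begin
    p ++ (w₁ ++ x ++ w₂) ++ q    ≡⟨ cong (p ++_) (++-assoc w₁ (x ++ w₂) q) ⟩
    p ++ w₁ ++ (x ++ w₂) ++ q    ≡⟨ cong (λ t → p ++ w₁ ++ t) (++-assoc x w₂ q) ⟩
    p ++ w₁ ++ x ++ w₂ ++ q      ≡⟨ ≡.sym (++-assoc p w₁ _) ⟩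
    (p ++ w₁) ++ x ++ w₂ ++ q    ∎
    where open ≡.≡-Reasoning

  length-<-insert : ∀ (A U B : List X) x → length (A ++ U ++ B) < length (A ++ U ++ x ∷ B)
  length-<-insert []      []      B x = n<1+n (length B)
  length-<-insert []      (_ ∷ U) B x = s≤s (length-<-insert [] U B x)
  length-<-insert (_ ∷ A) U       B x = s≤s (length-<-insert A U B x)

module _ {X : Set} {P Q : X → Set} where

  First? : (∀ x → Dec (P x)) → (∀ x → Dec (Q x)) → ∀ xs → Dec (First P Q xs)
  First? P? Q? []       = no λ ()
  First? P? Q? (x ∷ xs) with Q? x | P? x
  ... | yes qx | _      = yes [ qx ]
  ... | no ¬qx | no ¬px = no λ { [ qx ] → ¬qx qx ; (px ∷ _) → ¬px px }
  ... | no ¬qx | yes px = map′ (px ∷_) (First.tail ¬qx) (First? P? Q? xs)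

Marked : Set → Set
Marked X = List (X × Bool)

module _ {X : Set} where

  kill : ℕ → Marked X → Marked X
  kill _       []            = []
  kill zero    ((x , _) ∷ m) = (x , false) ∷ m
  kill (suc k) (e ∷ m)       = e ∷ kill k m

  live : Marked X → List X
  live []                = []
  live ((x , true)  ∷ m) = x ∷ live m
  live ((_ , false) ∷ m) = live m

  allLive : List X → Marked X
  allLive []       = []
  allLive (x ∷ xs) = (x , true) ∷ allLive xs

  LiveAt : Marked X → ℕ → X → Set
  LiveAt m k x = at m k ≡ just (x , true)

  AllLiveBetween : (X → Set) → Marked X → ℕ → ℕ → Set
  AllLiveBetween P m i j = ∀ k x → i < k → k < j → LiveAt m k x → P x

  LiveAt-functional : ∀ m k {x y} → LiveAt m k x → LiveAt m k y → x ≡ y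
  LiveAt-functional m k p q with ≡.trans (≡.sym p) q
  ... | refl = refl

  at-kill-≢ : ∀ e k m → k ≢ e → at (kill e m) k ≡ at m k
  at-kill-≢ e       k       []      _   = refl
  at-kill-≢ zero    zero    (_ ∷ m) k≢e = ⊥-elim (k≢e refl)
  at-kill-≢ zero    (suc k) (_ ∷ m) _   = refl
  at-kill-≢ (suc e) zero    (_ ∷ m) _   = refl
  at-kill-≢ (suc e) (suc k) (_ ∷ m) k≢e = at-kill-≢ e k m (λ k≡e → k≢e (cong suc k≡e))

  ¬LiveAt-kill : ∀ e m x → ¬ LiveAt (kill e m) e x
  ¬LiveAt-kill e       []      x ()
  ¬LiveAt-kill zero    (_ ∷ m) x ()
  ¬LiveAt-kill (suc e) (_ ∷ m) x live = ¬LiveAt-kill e m x live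

  LiveAt-kill⁻ : ∀ e k m {x} → LiveAt (kill e m) k x → k ≢ e × LiveAt m k x
  LiveAt-kill⁻ e k m {x} live with k ≟ e
  ... | yes refl = ⊥-elim (¬LiveAt-kill e m x live)
  ... | no k≢e   = k≢e , ≡.trans (≡.sym (at-kill-≢ e k m k≢e)) live

  LiveAt-kill⁺ : ∀ e k m {x} → k ≢ e → LiveAt m k x → LiveAt (kill e m) k x
  LiveAt-kill⁺ e k m k≢e live = ≡.trans (at-kill-≢ e k m k≢e) live

  kill-comm : ∀ d e m → kill d (kill e m) ≡ kill e (kill d m)
  kill-comm d       e       []      = refl
  kill-comm zero    zero    (_ ∷ m) = refl
  kill-comm zero    (suc e) (_ ∷ m) = refl
  kill-comm (suc d) zero    (_ ∷ m) = refl
  kill-comm (suc d) (suc e) (x ∷ m) = cong (x ∷_) (kill-comm d e m)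

  kill-++ : ∀ (A B : Marked X) k → kill (k + length A) (A ++ B) ≡ A ++ kill k B
  kill-++ []      B k rewrite +-identityʳ k          = refl
  kill-++ (x ∷ A) B k rewrite +-suc k (length A) = cong (x ∷_) (kill-++ A B k)

  live-++ : ∀ (A B : Marked X) → live (A ++ B) ≡ live A ++ live B
  live-++ []                B = refl
  live-++ ((x , true)  ∷ A) B = cong (x ∷_) (live-++ A B)
  live-++ ((_ , false) ∷ A) B = live-++ A B

  live-allLive : ∀ xs → live (allLive xs) ≡ xs
  live-allLive []       = refl
  live-allLive (x ∷ xs) = cong (x ∷_) (live-allLive xs)

  LiveAt⇒∈live : ∀ (A : Marked X) j {x} → LiveAt A j x → x ∈ live A
  LiveAt⇒∈live ((_ , true)  ∷ A) zero    refl = here refl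
  LiveAt⇒∈live ((_ , true)  ∷ A) (suc j) live = there (LiveAt⇒∈live A j live)
  LiveAt⇒∈live ((_ , false) ∷ A) (suc j) live = LiveAt⇒∈live A j live

  ∈live⇒LiveAt : ∀ (A : Marked X) {x} → x ∈ live A → ∃[ j ] LiveAt A j x
  ∈live⇒LiveAt ((_ , true) ∷ A) (here refl) = zero , refl
  ∈live⇒LiveAt ((_ , true) ∷ A) (there x∈) with ∈live⇒LiveAt A x∈
  ... | j , live = suc j , live
  ∈live⇒LiveAt ((_ , false) ∷ A) x∈ with ∈live⇒LiveAt A x∈
  ... | j , live = suc j , live

  live-split : ∀ (m : Marked X) xs a ys → live m ≡ xs ++ a ∷ ys →
               ∃[ A ] ∃[ B ] (m ≡ A ++ (a , true) ∷ B × live A ≡ xs × live B ≡ ys)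
  live-split []                []       a ys ()
  live-split []                (_ ∷ xs) a ys ()
  live-split ((b , false) ∷ m) xs       a ys eq with live-split m xs a ys eq
  ... | A , B , refl , refl , refl = (b , false) ∷ A , B , refl , refl , refl
  live-split ((b , true)  ∷ m) []       a ys eq with ∷-injective eq
  ... | refl , refl = [] , m , refl , refl , refl
  live-split ((b , true)  ∷ m) (_ ∷ xs) a ys eq with ∷-injective eq
  ... | refl , eq′ with live-split m xs a ys eq′
  ... | A , B , refl , refl , refl = (b , true) ∷ A , B , refl , refl , refl

  AllLiveBetween-kill : ∀ {P i j} e m → AllLiveBetween P m i j → AllLiveBetween P (kill e m) i j
  AllLiveBetween-kill e m between k x i<k k<j live =
    between k x i<k k<j (proj₂ (LiveAt-kill⁻ e k m live))

  AllLiveBetween-shrink : ∀ {P i i′ j j′} m → i ≤ i′ → j′ ≤ j →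
                          AllLiveBetween P m i j → AllLiveBetween P m i′ j′
  AllLiveBetween-shrink m i≤i′ j′≤j between k x i′<k k<j′ =
    between k x (≤-<-trans i≤i′ i′<k) (<-≤-trans k<j′ j′≤j)

  AllLiveBetween-join : ∀ {P i j k} m → AllLiveBetween P m i j → AllLiveBetween P m j k →
                        AllLiveBetween P (kill j m) i k
  AllLiveBetween-join {j = j} m left right l x i<l l<k live with LiveAt-kill⁻ j l m live | <-cmp l j
  ... | _   , live′ | tri< l<j _ _ = left l x i<l l<j live′
  ... | l≢j , _     | tri≈ _ l≡j _ = ⊥-elim (l≢j l≡j)
  ... | _   , live′ | tri> _ _ j<l = right l x j<l l<k live′

  AllLiveBetween-empty : ∀ {P i} m → AllLiveBetween P m i (suc i)
  AllLiveBetween-empty m k x i<k k<1+i = ⊥-elim (≤⇒≯ (≤-pred k<1+i) i<k)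

  AllLiveBetween-single : ∀ {P i y} m → LiveAt m (suc i) y → P y → AllLiveBetween P m i (suc (suc i))
  AllLiveBetween-single {P} {i} m live-y Py k x i<k k<2+i live-x
    with ≤-antisym (≤-pred k<2+i) i<k
  ... | refl = subst P (LiveAt-functional m (suc i) live-y live-x) Py

  AllLiveBetween-× : ∀ {P R i j} m → AllLiveBetween P m i j → AllLiveBetween R m i j →
                     AllLiveBetween (λ x → P x × R x) m i j
  AllLiveBetween-× m p r k x i<k k<j live = p k x i<k k<j live , r k x i<k k<j live

module Bracket {X : Set} (A Q S : Marked X) where

  bracket : X × Bool → X × Bool → Marked X
  bracket e₁ e₂ = A ++ e₁ ∷ Q ++ e₂ ∷ S

  first second : ℕ
  first  = length A
  second = suc (length Q) + length A

  first<second : first < second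
  first<second = s≤s (m≤n+m (length A) (length Q))

  at-first : ∀ e₁ e₂ → at (bracket e₁ e₂) first ≡ just e₁
  at-first e₁ e₂ = at-++ʳ A (e₁ ∷ Q ++ e₂ ∷ S) 0

  at-second : ∀ e₁ e₂ → at (bracket e₁ e₂) second ≡ just e₂
  at-second e₁ e₂ = ≡.trans (at-++ʳ A (e₁ ∷ Q ++ e₂ ∷ S) (suc (length Q))) (at-++ʳ Q (e₂ ∷ S) 0)

  live-bracket : ∀ a b → live (bracket (a , true) (b , true)) ≡ live A ++ a ∷ live Q ++ b ∷ live S
  live-bracket a b = ≡.trans (live-++ A _) (cong (λ R → live A ++ a ∷ R) (live-++ Q _))

  live-kill-first : ∀ a b →
                    live (kill first (bracket (a , true) (b , true))) ≡ live A ++ live Q ++ b ∷ live S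
  live-kill-first a b = begin
    live (kill first (bracket (a , true) (b , true)))  ≡⟨ cong live (kill-++ A _ 0) ⟩
    live (bracket (a , false) (b , true))              ≡⟨ live-++ A _ ⟩
    live A ++ live (Q ++ (b , true) ∷ S)               ≡⟨ cong (live A ++_) (live-++ Q _) ⟩
    live A ++ live Q ++ b ∷ live S                     ∎
    where open ≡.≡-Reasoning

  live-kill-second : ∀ a b →
                     live (kill second (bracket (a , true) (b , true))) ≡ live A ++ a ∷ live Q ++ live S
  live-kill-second a b = begin
    live (kill second (bracket (a , true) (b , true)))
      ≡⟨ cong live (kill-++ A _ (suc (length Q))) ⟩
    live (A ++ (a , true) ∷ kill (length Q) (Q ++ _))
      ≡⟨ cong (λ R → live (A ++ (a , true) ∷ R)) (kill-++ Q _ 0) ⟩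
    live (bracket (a , true) (b , false))               ≡⟨ live-++ A _ ⟩
    live A ++ a ∷ live (Q ++ (b , false) ∷ S)           ≡⟨ cong (λ R → live A ++ a ∷ R) (live-++ Q _) ⟩
    live A ++ a ∷ live Q ++ live S                      ∎
    where open ≡.≡-Reasoning

  between⇒All : ∀ {P e₁ e₂} → AllLiveBetween P (bracket e₁ e₂) first second → All P (live Q)
  between⇒All {e₁ = e₁} {e₂} between = All.tabulate λ {x} x∈ →
    let j , live = ∈live⇒LiveAt Q x∈
        j<Q      = at⇒<length Q j live
    in between (suc j + length A) x (s≤s (m≤n+m (length A) j)) (+-monoˡ-< (length A) (s≤s j<Q))
         (≡.trans (at-++ʳ A (e₁ ∷ Q ++ e₂ ∷ S) (suc j)) (≡.trans (at-++ˡ Q (e₂ ∷ S) j<Q) live))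

  All⇒between : ∀ {P e₁ e₂} → All P (live Q) → AllLiveBetween P (bracket e₁ e₂) first second
  All⇒between {e₁ = e₁} {e₂} all k x first<k k<second live with <⇒≡suc+ first<k
  ... | j , refl = All.lookup all (LiveAt⇒∈live Q j (≡.trans (≡.sym (at-++ˡ Q (e₂ ∷ S) j<Q))
                     (≡.trans (≡.sym (at-++ʳ A (e₁ ∷ Q ++ e₂ ∷ S) (suc j))) live)))
    where
    j<Q : j < length Q
    j<Q = ≤-pred (+-cancelʳ-< (length A) (suc j) (suc (length Q)) k<second)

module Triple {X : Set} (M N : Marked X) (b c : X) where

  triple : Marked X
  triple = M ++ (c , true) ∷ (b , true) ∷ (c , true) ∷ N

  live-kill-first : live (kill (length M) triple) ≡ live M ++ b ∷ c ∷ live N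
  live-kill-first = ≡.trans (cong live (kill-++ M _ 0)) (live-++ M _)

  live-kill-third : live (kill (2 + length M) triple) ≡ live M ++ c ∷ b ∷ live N
  live-kill-third = ≡.trans (cong live (kill-++ M _ 2)) (live-++ M _)

  live-kill-first-second : live (kill (1 + length M) (kill (length M) triple)) ≡ live M ++ c ∷ live N
  live-kill-first-second = begin
    live (kill (1 + length M) (kill (length M) triple))
      ≡⟨ cong (λ t → live (kill (1 + length M) t)) (kill-++ M _ 0) ⟩
    live (kill (1 + length M) (M ++ _))                     ≡⟨ cong live (kill-++ M _ 1) ⟩
    live (M ++ (c , false) ∷ (b , false) ∷ (c , true) ∷ N)  ≡⟨ live-++ M _ ⟩
    live M ++ c ∷ live N                                    ∎
    where open ≡.≡-Reasoning

  live-kill-third-second : live (kill (1 + length M) (kill (2 + length M) triple)) ≡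
                           live M ++ c ∷ live N
  live-kill-third-second = begin
    live (kill (1 + length M) (kill (2 + length M) triple))
      ≡⟨ cong (λ t → live (kill (1 + length M) t)) (kill-++ M _ 2) ⟩
    live (kill (1 + length M) (M ++ _))                     ≡⟨ cong live (kill-++ M _ 1) ⟩
    live (M ++ (c , true) ∷ (b , false) ∷ (c , false) ∷ N)  ≡⟨ live-++ M _ ⟩
    live M ++ c ∷ live N                                    ∎
    where open ≡.≡-Reasoning

live-kill-middle-triple : ∀ {X : Set} (m : Marked X) p {b c} →
                          LiveAt m p c → LiveAt m (suc p) b → LiveAt m (suc (suc p)) c →
                          live (kill (suc p) (kill p m)) ≡ live (kill (suc p) (kill (suc (suc p)) m))
live-kill-middle-triple m p {b} {c} c₀ b₁ c₂ with at⇒split₃ m p c₀ b₁ c₂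
... | M , N , refl , refl = ≡.trans live-kill-first-second (≡.sym live-kill-third-second)
  where open Triple M N b c

module Cancellation {n : ℕ} (Γ : Graph n) where

  private
    V : Set
    V = Fin n
    W : Set
    W = Word Γ
    Arr : V → V → Set
    Arr = Arrow Γ
    _⇝_ : W → W → Set
    _⇝_ = _⟶_ Γ
    _≃_ : W → W → Set
    _≃_ = _∼_ Γ

  _⇝*_ : W → W → Set
  _⇝*_ = Star _⇝_

  ≡⇒≃ : ∀ {u v} → u ≡ v → u ≃ v
  ≡⇒≃ refl = refl

  data Cancels (m : Marked V) (i d : ℕ) : Set where
    cancelᴿ : ∀ a → i < d → LiveAt m i a → LiveAt m d a →
              AllLiveBetween (λ x → ¬ Arr x a) m i d → Cancels m i d
    cancelᴸ : ∀ a → d < i → LiveAt m i a → LiveAt m d a →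
              AllLiveBetween (λ x → ¬ Arr a x) m d i → Cancels m i d

  Cancels-kill : ∀ {m i d} e → e ≢ i → e ≢ d → Cancels m i d → Cancels (kill e m) i d
  Cancels-kill {m} {i} {d} e e≢i e≢d (cancelᴿ a i<d ai ad between) =
    cancelᴿ a i<d (LiveAt-kill⁺ e i m (≢-sym e≢i) ai) (LiveAt-kill⁺ e d m (≢-sym e≢d) ad)
      (AllLiveBetween-kill e m between)
  Cancels-kill {m} {i} {d} e e≢i e≢d (cancelᴸ a d<i ai ad between) =
    cancelᴸ a d<i (LiveAt-kill⁺ e i m (≢-sym e≢i) ai) (LiveAt-kill⁺ e d m (≢-sym e≢d) ad)
      (AllLiveBetween-kill e m between)

  Cancels⇒⟶ : ∀ {m i d} → Cancels m i d → live m ⇝ live (kill d m)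
  Cancels⇒⟶ {m} (cancelᴿ a i<d ai ad between) with at⇒split₂ m i<d ai ad
  ... | A , Q , S , refl , refl , refl =
    subst₂ _⇝_ (≡.sym (live-bracket a a)) (≡.sym (live-kill-second a a))
      (cancelR (live A) (live S) a (live Q) (between⇒All between))
    where open Bracket A Q S
  Cancels⇒⟶ {m} (cancelᴸ a d<i ai ad between) with at⇒split₂ m d<i ad ai
  ... | A , Q , S , refl , refl , refl =
    subst₂ _⇝_ (≡.sym (live-bracket a a)) (≡.sym (live-kill-first a a))
      (cancelL (live A) (live S) a (live Q) (between⇒All between))
    where open Bracket A Q S

  ⟶⇒Cancels : ∀ m {w w′} → live m ≡ w → w ⇝ w′ →
              ∃[ i ] ∃[ d ] (Cancels m i d × w′ ≡ live (kill d m))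
  ⟶⇒Cancels m eq (cancelR w₁ w₂ a u all) with live-split m w₁ a (u ++ a ∷ w₂) eq
  ... | A , B , refl , refl , eqB with live-split B u a w₂ eqB
  ... | Q , S , refl , refl , refl =
    first , second ,
    cancelᴿ a first<second (at-first _ _) (at-second _ _) (All⇒between all) ,
    ≡.sym (live-kill-second a a)
    where open Bracket A Q S
  ⟶⇒Cancels m eq (cancelL w₁ w₂ a u all) with live-split m w₁ a (u ++ a ∷ w₂) eq
  ... | A , B , refl , refl , eqB with live-split B u a w₂ eqB
  ... | Q , S , refl , refl , refl =
    second , first ,
    cancelᴸ a first<second (at-second _ _) (at-first _ _) (All⇒between all) ,
    ≡.sym (live-kill-first a a)
    where open Bracket A Q S

  ∼-moveˡ : ∀ a X U Y → All (λ x → ¬ Arr a x × ¬ Arr x a) U → (X ++ U ++ a ∷ Y) ≃ (X ++ a ∷ U ++ Y)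
  ∼-moveˡ a X []      Y []                    = refl
  ∼-moveˡ a X (x ∷ U) Y ((a↛x , x↛a) ∷ all) =
    trans (subst₂ _≃_ (++-assoc X (x ∷ []) (U ++ a ∷ Y)) (++-assoc X (x ∷ []) (a ∷ U ++ Y))
                      (∼-moveˡ a (X ++ x ∷ []) U Y all))
          (sym (swap X (U ++ Y) a x a↛x x↛a))

  kill-twin-∼ : ∀ m {p q a} → p < q → LiveAt m p a → LiveAt m q a →
                AllLiveBetween (λ x → ¬ Arr a x × ¬ Arr x a) m p q →
                live (kill p m) ≃ live (kill q m)
  kill-twin-∼ m {a = a} p<q ap aq between with at⇒split₂ m p<q ap aq
  ... | A , Q , S , refl , refl , refl =
    subst₂ _≃_ (≡.sym (live-kill-first a a)) (≡.sym (live-kill-second a a))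
      (∼-moveˡ a (live A) (live Q) (live S) (between⇒All between))
    where open Bracket A Q S

  Joinable : W → W → Set
  Joinable u v = ∃[ u′ ] ∃[ v′ ] (u ⇝* u′ × v ⇝* v′ × u′ ≃ v′)

  Joinable-sym : ∀ {u v} → Joinable u v → Joinable v u
  Joinable-sym (u′ , v′ , u⇝*u′ , v⇝*v′ , u′≃v′) = v′ , u′ , v⇝*v′ , u⇝*u′ , sym u′≃v′

  ≃⇒Joinable : ∀ {u v} → u ≃ v → Joinable u v
  ≃⇒Joinable u≃v = _ , _ , ε , ε , u≃v

  joinable-kill-both : ∀ m {i₁ d₁ i₂ d₂} → Cancels (kill d₁ m) i₂ d₂ → Cancels (kill d₂ m) i₁ d₁ →
                       Joinable (live (kill d₁ m)) (live (kill d₂ m))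
  joinable-kill-both m {d₁ = d₁} {d₂ = d₂} c₂ c₁ =
    _ , _ , Cancels⇒⟶ c₂ ◅ ε , Cancels⇒⟶ c₁ ◅ ε , ≡⇒≃ (cong live (kill-comm d₂ d₁ m))

  joinable-mutual : ∀ m {d₁ d₂} → Cancels m d₂ d₁ → Cancels m d₁ d₂ →
                    Joinable (live (kill d₁ m)) (live (kill d₂ m))
  joinable-mutual m (cancelᴿ _ d₂<d₁ _ _ _) (cancelᴿ _ d₁<d₂ _ _ _) = ⊥-elim (<-asym d₂<d₁ d₁<d₂)
  joinable-mutual m (cancelᴸ _ d₁<d₂ _ _ _) (cancelᴸ _ d₂<d₁ _ _ _) = ⊥-elim (<-asym d₂<d₁ d₁<d₂)
  joinable-mutual m {d₂ = d₂} (cancelᴿ a d₂<d₁ a₂ a₁ gap₁) (cancelᴸ b _ _ b₂ gap₂)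
    with LiveAt-functional m d₂ a₂ b₂
  ... | refl = ≃⇒Joinable (sym (kill-twin-∼ m d₂<d₁ a₂ a₁ (AllLiveBetween-× m gap₂ gap₁)))
  joinable-mutual m {d₁} (cancelᴸ a d₁<d₂ a₂ a₁ gap₁) (cancelᴿ b _ b₁ _ gap₂)
    with LiveAt-functional m d₁ a₁ b₁
  ... | refl = ≃⇒Joinable (kill-twin-∼ m d₁<d₂ a₁ a₂ (AllLiveBetween-× m gap₁ gap₂))

  joinable-chain : ∀ m {d₁ d₂ i₂} → i₂ ≢ d₁ → d₁ ≢ d₂ → Cancels m d₂ d₁ → Cancels m i₂ d₂ →
                   Joinable (live (kill d₁ m)) (live (kill d₂ m))
  joinable-chain m {d₁} {d₂} {i₂} i₂≢d₁ d₁≢d₂ c₁ c₂ = go c₁ c₂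
    where
    kill-both : Cancels (kill d₂ m) i₂ d₁ → Joinable (live (kill d₁ m)) (live (kill d₂ m))
    kill-both = joinable-kill-both m (Cancels-kill d₁ (≢-sym i₂≢d₁) d₁≢d₂ c₂)

    live₂ : ∀ {k x} → k ≢ d₂ → LiveAt m k x → LiveAt (kill d₂ m) k x
    live₂ {k} = LiveAt-kill⁺ d₂ k m

    go : Cancels m d₂ d₁ → Cancels m i₂ d₂ → Joinable (live (kill d₁ m)) (live (kill d₂ m))
    go (cancelᴿ a d₂<d₁ a₂ a₁ gap₁) (cancelᴿ b i₂<d₂ bi b₂ gap₂) with LiveAt-functional m d₂ a₂ b₂
    ... | refl = kill-both (cancelᴿ a (<-trans i₂<d₂ d₂<d₁) (live₂ (<⇒≢ i₂<d₂) bi)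
                   (live₂ (>⇒≢ d₂<d₁) a₁) (AllLiveBetween-join m gap₂ gap₁))
    go (cancelᴸ a d₁<d₂ a₂ a₁ gap₁) (cancelᴸ b d₂<i₂ bi b₂ gap₂) with LiveAt-functional m d₂ a₂ b₂
    ... | refl = kill-both (cancelᴸ a (<-trans d₁<d₂ d₂<i₂) (live₂ (>⇒≢ d₂<i₂) bi)
                   (live₂ (<⇒≢ d₁<d₂) a₁) (AllLiveBetween-join m gap₁ gap₂))
    go (cancelᴿ a d₂<d₁ a₂ a₁ gap₁) (cancelᴸ b d₂<i₂ bi b₂ gap₂)
      with LiveAt-functional m d₂ a₂ b₂ | <-cmp i₂ d₁
    ... | refl | tri< i₂<d₁ _ _ = kill-both (cancelᴿ a i₂<d₁ (live₂ (>⇒≢ d₂<i₂) bi) (live₂ (>⇒≢ d₂<d₁) a₁)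
                                    (AllLiveBetween-kill d₂ m (AllLiveBetween-shrink m (<⇒≤ d₂<i₂) ≤-refl gap₁)))
    ... | refl | tri≈ _ i₂≡d₁ _ = ⊥-elim (i₂≢d₁ i₂≡d₁)
    ... | refl | tri> _ _ d₁<i₂ = ≃⇒Joinable (sym (kill-twin-∼ m d₂<d₁ a₂ a₁
                                    (AllLiveBetween-× m (AllLiveBetween-shrink m ≤-refl (<⇒≤ d₁<i₂) gap₂) gap₁)))
    go (cancelᴸ a d₁<d₂ a₂ a₁ gap₁) (cancelᴿ b i₂<d₂ bi b₂ gap₂)
      with LiveAt-functional m d₂ a₂ b₂ | <-cmp i₂ d₁
    ... | refl | tri< i₂<d₁ _ _ = ≃⇒Joinable (kill-twin-∼ m d₁<d₂ a₁ a₂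
                                    (AllLiveBetween-× m gap₁ (AllLiveBetween-shrink m (<⇒≤ i₂<d₁) ≤-refl gap₂)))
    ... | refl | tri≈ _ i₂≡d₁ _ = ⊥-elim (i₂≢d₁ i₂≡d₁)
    ... | refl | tri> _ _ d₁<i₂ = kill-both (cancelᴸ a d₁<i₂ (live₂ (<⇒≢ i₂<d₂) bi) (live₂ (<⇒≢ d₁<d₂) a₁)
                                    (AllLiveBetween-kill d₂ m (AllLiveBetween-shrink m ≤-refl (<⇒≤ i₂<d₂) gap₁)))

  Cancels-joinable : ∀ m {i₁ d₁ i₂ d₂} → Cancels m i₁ d₁ → Cancels m i₂ d₂ →
                     Joinable (live (kill d₁ m)) (live (kill d₂ m))
  Cancels-joinable m {i₁} {d₁} {i₂} {d₂} c₁ c₂ with d₁ ≟ d₂ | d₂ ≟ i₁ | d₁ ≟ i₂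
  ... | yes refl | _        | _        = ≃⇒Joinable refl
  ... | no d₁≢d₂ | yes refl | yes refl = joinable-mutual m c₁ c₂
  ... | no d₁≢d₂ | yes refl | no d₁≢i₂ = joinable-chain m (≢-sym d₁≢i₂) d₁≢d₂ c₁ c₂
  ... | no d₁≢d₂ | no d₂≢i₁ | yes refl = Joinable-sym (joinable-chain m (≢-sym d₂≢i₁) (≢-sym d₁≢d₂) c₂ c₁)
  ... | no d₁≢d₂ | no d₂≢i₁ | no d₁≢i₂ =
    joinable-kill-both m (Cancels-kill d₁ d₁≢i₂ d₁≢d₂ c₂) (Cancels-kill d₂ d₂≢i₁ (≢-sym d₁≢d₂) c₁)

  ⟶-locallyConfluent : ∀ {w u v} → w ⇝ u → w ⇝ v → Joinable u v
  ⟶-locallyConfluent {w} w⇝u w⇝v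
    with ⟶⇒Cancels (allLive w) (live-allLive w) w⇝u | ⟶⇒Cancels (allLive w) (live-allLive w) w⇝v
  ... | _ , _ , c₁ , refl | _ , _ , c₂ , refl = Cancels-joinable (allLive w) c₁ c₂

  Cancels-target : ∀ {m i d} → Cancels m i d → ∃[ a ] LiveAt m d a
  Cancels-target (cancelᴿ a _ _ ad _) = a , ad
  Cancels-target (cancelᴸ a _ _ ad _) = a , ad

  swap-triple-∼ : ∀ m p {b c} → ¬ Arr b c → ¬ Arr c b →
                  LiveAt m p c → LiveAt m (suc p) b → LiveAt m (suc (suc p)) c →
                  live (kill p m) ≃ live (kill (suc (suc p)) m)
  swap-triple-∼ m p {b} {c} b↛c c↛b c₀ b₁ c₂ with at⇒split₃ m p c₀ b₁ c₂
  ... | M , N , refl , refl =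
    subst₂ _≃_ (≡.sym live-kill-first) (≡.sym live-kill-third) (swap (live M) (live N) b c b↛c c↛b)
    where open Triple M N b c

  module SwapSimulation (m : Marked V) (p : ℕ) {b c : V} (b↛c : ¬ Arr b c) (c↛b : ¬ Arr c b)
                        (c₀ : LiveAt m p c) (b₁ : LiveAt m (suc p) b) (c₂ : LiveAt m (suc (suc p)) c) where

    p₁ p₂ : ℕ
    p₁ = suc p
    p₂ = suc p₁

    A B : Marked V
    A = kill p m
    B = kill p₂ m

    p<p₂ : p < p₂
    p<p₂ = <-trans (n<1+n p) (n<1+n p₁)

    A-dead : ∀ {k x} → LiveAt A k x → k ≢ p
    A-dead {k} live = proj₁ (LiveAt-kill⁻ p k m live)

    A⇒B-live : ∀ {k x} → k ≢ p₂ → LiveAt A k x → LiveAt B k x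
    A⇒B-live {k} k≢p₂ live = LiveAt-kill⁺ p₂ k m k≢p₂ (proj₂ (LiveAt-kill⁻ p k m live))

    A₁ : LiveAt A p₁ b
    A₁ = LiveAt-kill⁺ p p₁ m (>⇒≢ (n<1+n p)) b₁

    A₂ : LiveAt A p₂ c
    A₂ = LiveAt-kill⁺ p p₂ m (>⇒≢ p<p₂) c₂

    B₀ : LiveAt B p c
    B₀ = LiveAt-kill⁺ p₂ p m (<⇒≢ p<p₂) c₀

    B₁ : LiveAt B p₁ b
    B₁ = LiveAt-kill⁺ p₂ p₁ m (<⇒≢ (n<1+n p₁)) b₁

    A⇒m-gap : ∀ {P i j} → AllLiveBetween P A i j → (i < p → p < j → P c) → AllLiveBetween P m i j
    A⇒m-gap {P} gap at-p k x i<k k<j live with k ≟ p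
    ... | yes refl = subst P (LiveAt-functional m p c₀ live) (at-p i<k k<j)
    ... | no k≢p   = gap k x i<k k<j (LiveAt-kill⁺ p k m k≢p live)

    A⇒B-gap : ∀ {P i j} → AllLiveBetween P A i j → (i < p → p < j → P c) → AllLiveBetween P B i j
    A⇒B-gap gap at-p = AllLiveBetween-kill p₂ m (A⇒m-gap gap at-p)

    right-of-p : ∀ {i j} {Q : Set} → p ≤ i → i < p → p < j → Q
    right-of-p p≤i i<p _ = ⊥-elim (≤⇒≯ p≤i i<p)

    left-of-p : ∀ {i j} {Q : Set} → j ≤ p → i < p → p < j → Q
    left-of-p j≤p _ p<j = ⊥-elim (≤⇒≯ j≤p p<j)

    beyond-p₂ : ∀ {k} → p < k → k ≢ p₁ → k ≢ p₂ → p₂ < k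
    beyond-p₂ p<k k≢p₁ k≢p₂ = ≤∧≢⇒< (≤∧≢⇒< p<k (≢-sym k≢p₁)) (≢-sym k≢p₂)

    kill-p₁-∼ : live (kill p₁ A) ≃ live (kill p₁ B)
    kill-p₁-∼ = ≡⇒≃ (live-kill-middle-triple m p {b} {c} c₀ b₁ c₂)

    kill-p₂-∼ : live (kill p₂ A) ≃ live (kill p B)
    kill-p₂-∼ = ≡⇒≃ (cong live (kill-comm p₂ p m))

    gap-across-p₁ : ∀ {P j} → P b → AllLiveBetween P A p₂ j → AllLiveBetween P B p j
    gap-across-p₁ Pb gap =
      AllLiveBetween-join m (AllLiveBetween-single m b₁ Pb) (A⇒m-gap gap (right-of-p (<⇒≤ p<p₂)))

    Simulated : ℕ → Set
    Simulated d = ∃[ i′ ] ∃[ d′ ] (Cancels B i′ d′ × live (kill d A) ≃ live (kill d′ B))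

    simulate-p₂ : ∀ {i} → Cancels A i p₂ → Simulated p₂
    simulate-p₂ {i} (cancelᴿ a i<p₂ ai a₂ gap) with LiveAt-functional A p₂ a₂ A₂ | <-cmp i p
    ... | refl | tri< i<p _ _ =
      i , p , cancelᴿ c i<p (A⇒B-live (<⇒≢ i<p₂) ai) B₀
                (A⇒B-gap (AllLiveBetween-shrink A ≤-refl (<⇒≤ p<p₂) gap) (left-of-p ≤-refl)) ,
      kill-p₂-∼
    ... | refl | tri≈ _ i≡p _ = ⊥-elim (A-dead ai i≡p)
    ... | refl | tri> _ _ p<i with ≤-antisym (≤-pred i<p₂) p<i
    ...   | refl with LiveAt-functional A p₁ ai A₁
    ...     | refl = p₁ , p , cancelᴸ c (n<1+n p) B₁ B₀ (AllLiveBetween-empty B) , kill-p₂-∼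
    simulate-p₂ {i} (cancelᴸ a p₂<i ai a₂ gap) with LiveAt-functional A p₂ a₂ A₂
    ... | refl =
      i , p , cancelᴸ c (<-trans p<p₂ p₂<i) (A⇒B-live (>⇒≢ p₂<i) ai) B₀ (gap-across-p₁ c↛b gap) ,
      kill-p₂-∼

    simulate-p₁ : ∀ {i} → Cancels A i p₁ → Simulated p₁
    simulate-p₁ {i} (cancelᴿ a i<p₁ ai a₁ gap) with LiveAt-functional A p₁ a₁ A₁ | <-cmp i p
    ... | refl | tri< i<p _ _ =
      i , p₁ , cancelᴿ b i<p₁ (A⇒B-live (<⇒≢ (<-trans i<p₁ (n<1+n p₁))) ai) B₁
                 (A⇒B-gap gap (λ _ _ → c↛b)) ,
      kill-p₁-∼
    ... | refl | tri≈ _ i≡p _ = ⊥-elim (A-dead ai i≡p)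
    ... | refl | tri> _ _ p<i = ⊥-elim (≤⇒≯ (≤-pred i<p₁) p<i)
    simulate-p₁ {i} (cancelᴸ a p₁<i ai a₁ gap) with LiveAt-functional A p₁ a₁ A₁ | i ≟ p₂
    ... | refl | yes refl with LiveAt-functional A p₂ ai A₂
    ...   | refl = p , p₁ , cancelᴿ b (n<1+n p) B₀ B₁ (AllLiveBetween-empty B) , kill-p₁-∼
    simulate-p₁ {i} (cancelᴸ a p₁<i ai a₁ gap) | refl | no i≢p₂ =
      i , p₁ , cancelᴸ b p₁<i (A⇒B-live i≢p₂ ai) B₁ (A⇒B-gap gap (right-of-p (<⇒≤ (n<1+n p)))) ,
      kill-p₁-∼

    Cancels-elsewhere : ∀ {i d} → d ≢ p₁ → d ≢ p₂ → Cancels A i d → ∃[ i′ ] Cancels B i′ d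
    Cancels-elsewhere {i} {d} d≢p₁ d≢p₂ (cancelᴿ a i<d ai ad gap) with i ≟ p₁ | i ≟ p₂
    ... | _ | yes refl with LiveAt-functional A p₂ ai A₂
    ...   | refl = p , cancelᴿ c (<-trans p<p₂ i<d) B₀ (A⇒B-live d≢p₂ ad) (gap-across-p₁ b↛c gap)
    Cancels-elsewhere d≢p₁ d≢p₂ (cancelᴿ a i<d ai ad gap) | yes refl | no _ with LiveAt-functional A p₁ ai A₁
    ...   | refl = p₁ , cancelᴿ b i<d B₁ (A⇒B-live d≢p₂ ad) (A⇒B-gap gap (right-of-p (<⇒≤ (n<1+n p))))
    Cancels-elsewhere {i} {d} d≢p₁ d≢p₂ (cancelᴿ a i<d ai ad gap) | no i≢p₁ | no i≢p₂ =
      i , cancelᴿ a i<d (A⇒B-live i≢p₂ ai) (A⇒B-live d≢p₂ ad)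
            (A⇒B-gap gap (λ i<p p<d → gap p₂ c (<-trans i<p p<p₂) (beyond-p₂ p<d d≢p₁ d≢p₂) A₂))
    Cancels-elsewhere {i} {d} d≢p₁ d≢p₂ (cancelᴸ a d<i ai ad gap) with i ≟ p₁ | i ≟ p₂
    ... | _ | yes refl with LiveAt-functional A p₂ ai A₂
    ...   | refl = p , cancelᴸ c d<p B₀ (A⇒B-live d≢p₂ ad)
                         (A⇒B-gap (AllLiveBetween-shrink A ≤-refl (<⇒≤ p<p₂) gap) (left-of-p ≤-refl))
      where
      d<p : d < p
      d<p = ≤∧≢⇒< (≤-pred (≤∧≢⇒< (≤-pred d<i) d≢p₁)) (A-dead ad)
    Cancels-elsewhere d≢p₁ d≢p₂ (cancelᴸ a d<i ai ad gap) | yes refl | no _ with LiveAt-functional A p₁ ai A₁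
    ...   | refl = p₁ , cancelᴸ b d<i B₁ (A⇒B-live d≢p₂ ad) (A⇒B-gap gap (λ _ _ → b↛c))
    Cancels-elsewhere {i} {d} d≢p₁ d≢p₂ (cancelᴸ a d<i ai ad gap) | no i≢p₁ | no i≢p₂ =
      i , cancelᴸ a d<i (A⇒B-live i≢p₂ ai) (A⇒B-live d≢p₂ ad)
            (A⇒B-gap gap (λ d<p p<i → gap p₂ c (<-trans d<p p<p₂) (beyond-p₂ p<i i≢p₁ i≢p₂) A₂))

    simulate : ∀ {i d} → Cancels A i d → Simulated d
    simulate {i} {d} c with d ≟ p₁ | d ≟ p₂
    ... | yes refl | _        = simulate-p₁ c
    ... | no _     | yes refl = simulate-p₂ c
    ... | no d≢p₁  | no d≢p₂  =
      let i′ , c′ = Cancels-elsewhere d≢p₁ d≢p₂ c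
          d≢p     = A-dead (proj₂ (Cancels-target c))
      in i′ , d , c′ ,
         subst₂ _≃_ (cong live (kill-comm p d m)) (cong live (kill-comm p₂ d m))
           (swap-triple-∼ (kill d m) p b↛c c↛b (LiveAt-kill⁺ d p m (≢-sym d≢p) c₀)
             (LiveAt-kill⁺ d p₁ m (≢-sym d≢p₁) b₁) (LiveAt-kill⁺ d p₂ m (≢-sym d≢p₂) c₂))

  ∼-swap-simulates : ∀ w₁ w₂ x y → ¬ Arr x y → ¬ Arr y x → ∀ {u′} → (w₁ ++ x ∷ y ∷ w₂) ⇝ u′ →
                     ∃[ v′ ] ((w₁ ++ y ∷ x ∷ w₂) ⇝ v′ × u′ ≃ v′)
  ∼-swap-simulates w₁ w₂ x y x↛y y↛x u⇝u′ =
    let _ , d  , c  , u′≡ = ⟶⇒Cancels A live-A u⇝u′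
        _ , d′ , c′ , u′≃ = simulate c
    in live (kill d′ B) , subst (_⇝ live (kill d′ B)) live-B (Cancels⇒⟶ c′) ,
       subst (_≃ live (kill d′ B)) (≡.sym u′≡) u′≃
    where
    open Triple (allLive w₁) (allLive w₂) x y
    open SwapSimulation triple (length (allLive w₁)) x↛y y↛x
           (at-++ʳ (allLive w₁) _ 0) (at-++ʳ (allLive w₁) _ 1) (at-++ʳ (allLive w₁) _ 2)

    live-A : live A ≡ w₁ ++ x ∷ y ∷ w₂
    live-A = ≡.trans live-kill-first (cong₂ (λ s t → s ++ x ∷ y ∷ t) (live-allLive w₁) (live-allLive w₂))

    live-B : live B ≡ w₁ ++ y ∷ x ∷ w₂
    live-B = ≡.trans live-kill-third (cong₂ (λ s t → s ++ y ∷ x ∷ t) (live-allLive w₁) (live-allLive w₂))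

  Simulates : W → W → Set
  Simulates u v = ∀ {u′} → u ⇝ u′ → ∃[ v′ ] (v ⇝ v′ × u′ ≃ v′)

  Simulates-trans : ∀ {u v w} → Simulates u v → Simulates v w → Simulates u w
  Simulates-trans u≲v v≲w u⇝u′ =
    let v′ , v⇝v′ , u′≃v′ = u≲v u⇝u′
        w′ , w⇝w′ , v′≃w′ = v≲w v⇝v′
    in w′ , w⇝w′ , trans u′≃v′ v′≃w′

  ∼⇒Simulates : ∀ {u v} → u ≃ v → Simulates u v × Simulates v u
  ∼⇒Simulates (swap w₁ w₂ a b a↛b b↛a) =
    ∼-swap-simulates w₁ w₂ a b a↛b b↛a , ∼-swap-simulates w₁ w₂ b a b↛a a↛b
  ∼⇒Simulates refl            = (λ s → _ , s , refl) , (λ s → _ , s , refl)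
  ∼⇒Simulates (sym v≃u)       = Product.swap (∼⇒Simulates v≃u)
  ∼⇒Simulates (trans u≃v v≃w) =
    let u≲v , v≲u = ∼⇒Simulates u≃v
        v≲w , w≲v = ∼⇒Simulates v≃w
    in Simulates-trans u≲v v≲w , Simulates-trans w≲v v≲u

  ∼-simulates* : ∀ {u v z} → u ≃ v → u ⇝* z → ∃[ z′ ] (v ⇝* z′ × z ≃ z′)
  ∼-simulates* u≃v ε                = _ , ε , u≃v
  ∼-simulates* u≃v (u⇝u′ ◅ u′⇝*z) =
    let v′ , v⇝v′ , u′≃v′ = proj₁ (∼⇒Simulates u≃v) u⇝u′
        z′ , v′⇝*z′ , z≃z′ = ∼-simulates* u′≃v′ u′⇝*z
    in z′ , v⇝v′ ◅ v′⇝*z′ , z≃z′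

  IsNormalForm-∼ : ∀ {u v} → u ≃ v → IsNormalForm Γ u → IsNormalForm Γ v
  IsNormalForm-∼ u≃v u-normal v′ v⇝v′ =
    let u′ , u⇝u′ , _ = proj₂ (∼⇒Simulates u≃v) v⇝v′ in u-normal u′ u⇝u′

  ⟶-shrinks : ∀ {u v} → u ⇝ v → length v < length u
  ⟶-shrinks (cancelR w₁ w₂ a u _) = length-<-insert w₁ (a ∷ u) w₂ a
  ⟶-shrinks (cancelL w₁ w₂ a u _) = length-<-insert w₁ [] (u ++ a ∷ w₂) a

  ⟶-∷ : ∀ a {u v} → u ⇝ v → (a ∷ u) ⇝ (a ∷ v)
  ⟶-∷ a (cancelR w₁ w₂ b u all) = cancelR (a ∷ w₁) w₂ b u all
  ⟶-∷ a (cancelL w₁ w₂ b u all) = cancelL (a ∷ w₁) w₂ b u all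

  HeadRedex : V → W → Set
  HeadRedex a r = First (λ x → ¬ Arr x a) (_≡ a) r ⊎ First (λ x → ¬ Arr a x) (_≡ a) r

  headRedex? : ∀ a r → Dec (HeadRedex a r)
  headRedex? a r = First? (λ x → ¬? (T? (Γ x a))) (Fin._≟ a) r
           ⊎-dec First? (λ x → ¬? (T? (Γ a x))) (Fin._≟ a) r

  HeadRedex⇒⟶ : ∀ {a r} → HeadRedex a r → ∃[ w′ ] (a ∷ r) ⇝ w′
  HeadRedex⇒⟶ {a} (inj₁ redex) with toView redex
  ... | firstView {U} all refl Y = _ , cancelR [] Y a U all
  HeadRedex⇒⟶ {a} (inj₂ redex) with toView redex
  ... | firstView {U} all refl Y = _ , cancelL [] Y a U all

  ∷-⟶⁻ : ∀ {a r w w′} → w ⇝ w′ → w ≡ a ∷ r → HeadRedex a r ⊎ ∃[ r′ ] r ⇝ r′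
  ∷-⟶⁻ (cancelR []       w₂ _ _ all) refl = inj₁ (inj₁ (fromView (firstView all refl w₂)))
  ∷-⟶⁻ (cancelR (_ ∷ w₁) w₂ b u all) refl = inj₂ (_ , cancelR w₁ w₂ b u all)
  ∷-⟶⁻ (cancelL []       w₂ _ _ all) refl = inj₁ (inj₂ (fromView (firstView all refl w₂)))
  ∷-⟶⁻ (cancelL (_ ∷ w₁) w₂ b u all) refl = inj₂ (_ , cancelL w₁ w₂ b u all)

  ⟶-or-IsNormalForm : ∀ w → (∃[ w′ ] w ⇝ w′) ⊎ IsNormalForm Γ w
  ⟶-or-IsNormalForm []      = inj₂ λ _ []⇝ → n≮0 (⟶-shrinks []⇝)
  ⟶-or-IsNormalForm (a ∷ r) with headRedex? a r | ⟶-or-IsNormalForm r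
  ... | yes redex | _                  = inj₁ (HeadRedex⇒⟶ redex)
  ... | no _      | inj₁ (r′ , r⇝r′) = inj₁ (a ∷ r′ , ⟶-∷ a r⇝r′)
  ... | no ¬redex | inj₂ r-normal      =
    inj₂ λ w′ w⇝w′ → Sum.[ ¬redex , (λ (r′ , r⇝r′) → r-normal r′ r⇝r′) ] (∷-⟶⁻ w⇝w′ refl)

  Shorter : W → W → Set
  Shorter = _<_ on length

  Shorter-wellFounded : WellFounded Shorter
  Shorter-wellFounded = On.wellFounded length <-wellFounded

  normalize : ∀ w → Acc Shorter w → ∃[ z ] (w ⇝* z × IsNormalForm Γ z)
  normalize w (acc rs) with ⟶-or-IsNormalForm w
  ... | inj₂ w-normal    = w , ε , w-normal
  ... | inj₁ (w′ , w⇝w′) =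
    let z , w′⇝*z , z-normal = normalize w′ (rs (⟶-shrinks w⇝w′)) in z , w⇝w′ ◅ w′⇝*z , z-normal

  normalForms-∼ : ∀ {w z₁ z₂} → Acc Shorter w → w ⇝* z₁ → w ⇝* z₂ →
                  IsNormalForm Γ z₁ → IsNormalForm Γ z₂ → z₁ ≃ z₂
  normalForms-∼ _ ε ε _ _ = refl
  normalForms-∼ _ ε (w⇝ ◅ _) z₁-normal _ = ⊥-elim (z₁-normal _ w⇝)
  normalForms-∼ _ (w⇝ ◅ _) ε _ z₂-normal = ⊥-elim (z₂-normal _ w⇝)
  normalForms-∼ (acc rs) (w⇝u ◅ u⇝*z₁) (w⇝v ◅ v⇝*z₂) z₁-normal z₂-normal =
    let u′ , v′ , u⇝*u′ , v⇝*v′ , u′≃v′ = ⟶-locallyConfluent w⇝u w⇝v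
        z , u′⇝*z , z-normal = normalize u′ (Shorter-wellFounded u′)
        z′ , v′⇝*z′ , z≃z′ = ∼-simulates* u′≃v′ u′⇝*z
        z₁≃z = normalForms-∼ (rs (⟶-shrinks w⇝u)) u⇝*z₁ (u⇝*u′ ◅◅ u′⇝*z) z₁-normal z-normal
        z₂≃z′ = normalForms-∼ (rs (⟶-shrinks w⇝v)) v⇝*z₂ (v⇝*v′ ◅◅ v′⇝*z′) z₂-normal
                  (IsNormalForm-∼ z≃z′ z-normal)
    in trans z₁≃z (trans z≃z′ (sym z₂≃z′))

  nf : W → W
  nf w = proj₁ (normalize w (Shorter-wellFounded w))

  ⇝*nf : ∀ w → w ⇝* nf w
  ⇝*nf w = proj₁ (proj₂ (normalize w (Shorter-wellFounded w)))

  nf-isNormalForm : ∀ w → IsNormalForm Γ (nf w)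
  nf-isNormalForm w = proj₂ (proj₂ (normalize w (Shorter-wellFounded w)))

  IsNormalForm-∼nf : ∀ {w z} → w ⇝* z → IsNormalForm Γ z → z ≃ nf w
  IsNormalForm-∼nf {w} w⇝*z z-normal =
    normalForms-∼ (Shorter-wellFounded w) w⇝*z (⇝*nf w) z-normal (nf-isNormalForm w)

  nf-cong-⟶ : ∀ {u v} → u ⇝ v → nf u ≃ nf v
  nf-cong-⟶ {v = v} u⇝v = sym (IsNormalForm-∼nf (u⇝v ◅ ⇝*nf v) (nf-isNormalForm v))

  nf-cong-∼ : ∀ {u v} → u ≃ v → nf u ≃ nf v
  nf-cong-∼ {u} u≃v =
    let z , v⇝*z , nf-u≃z = ∼-simulates* u≃v (⇝*nf u)
    in trans nf-u≃z (IsNormalForm-∼nf v⇝*z (IsNormalForm-∼ nf-u≃z (nf-isNormalForm u)))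

  nf-cong-≈HK : (∀ a b → Arr a b → ¬ Arr b a) → ∀ {u v} → _≈HK_ Γ u v → nf u ≃ nf v
  nf-cong-≈HK asym (step w₁ w₂ (idem a))            = nf-cong-⟶ (cancelR w₁ w₂ a [] [])
  nf-cong-≈HK asym (step w₁ w₂ (arr₁ a b a→b))      = nf-cong-⟶ (cancelR w₁ w₂ a (b ∷ []) (asym a b a→b ∷ []))
  nf-cong-≈HK asym (step w₁ w₂ (arr₂ a b a→b))      = nf-cong-⟶ (cancelL w₁ w₂ b (a ∷ []) (asym a b a→b ∷ []))
  nf-cong-≈HK asym (step w₁ w₂ (comm a b a↛b b↛a)) = nf-cong-∼ (swap w₁ w₂ a b a↛b b↛a)
  nf-cong-≈HK asym refl                             = refl
  nf-cong-≈HK asym (sym v≈u)                        = sym (nf-cong-≈HK asym v≈u)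
  nf-cong-≈HK asym (trans u≈v v≈w)                  = trans (nf-cong-≈HK asym u≈v) (nf-cong-≈HK asym v≈w)

  IsNormalForm-≈HK⇒∼ : (∀ a b → Arr a b → ¬ Arr b a) → ∀ {u v} →
                       IsNormalForm Γ u → IsNormalForm Γ v → _≈HK_ Γ u v → u ≃ v
  IsNormalForm-≈HK⇒∼ asym u-normal v-normal u≈v =
    trans (IsNormalForm-∼nf ε u-normal) (trans (nf-cong-≈HK asym u≈v) (sym (IsNormalForm-∼nf ε v-normal)))

  private
    _≈_ : W → W → Set
    _≈_ = _≈HK_ Γ

  ≈-cong : ∀ p q {x y} → x ≈ y → (p ++ x ++ q) ≈ (p ++ y ++ q)
  ≈-cong p q (step w₁ w₂ {x} {y} r) =
    subst₂ _≈_ (≡.sym (++-assoc-middle p w₁ x w₂ q)) (≡.sym (++-assoc-middle p w₁ y w₂ q))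
      (step (p ++ w₁) (w₂ ++ q) r)
  ≈-cong p q refl            = refl
  ≈-cong p q (sym y≈x)       = sym (≈-cong p q y≈x)
  ≈-cong p q (trans x≈y y≈z) = trans (≈-cong p q x≈y) (≈-cong p q y≈z)

  ≈-congˡ : ∀ p {x y} → x ≈ y → (p ++ x) ≈ (p ++ y)
  ≈-congˡ p {x} {y} x≈y =
    subst₂ _≈_ (cong (p ++_) (++-identityʳ x)) (cong (p ++_) (++-identityʳ y)) (≈-cong p [] x≈y)

  axa≈ax : ∀ a x → ¬ Arr x a → (a ∷ x ∷ a ∷ []) ≈ (a ∷ x ∷ [])
  axa≈ax a x x↛a with x Fin.≟ a | T? (Γ a x)
  ... | yes refl | _       = step (a ∷ []) [] (idem a)
  ... | no _     | yes a→x = step [] [] (arr₁ a x a→x)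
  ... | no _     | no a↛x  = trans (step (a ∷ []) [] (comm x a x↛a a↛x)) (step [] (x ∷ []) (idem a))

  axa≈xa : ∀ a x → ¬ Arr a x → (a ∷ x ∷ a ∷ []) ≈ (x ∷ a ∷ [])
  axa≈xa a x a↛x with x Fin.≟ a | T? (Γ x a)
  ... | yes refl | _       = step (a ∷ []) [] (idem a)
  ... | no _     | yes x→a = step [] [] (arr₂ x a x→a)
  ... | no _     | no x↛a  = trans (step [] (a ∷ []) (comm a x a↛x x↛a)) (step (x ∷ []) [] (idem a))

  aua≈au : ∀ a u → All (λ x → ¬ Arr x a) u → (a ∷ u ++ a ∷ []) ≈ (a ∷ u)
  aua≈au a []      []            = step [] [] (idem a)
  aua≈au a (x ∷ u) (x↛a ∷ u↛a) =
    trans (≈-cong [] (u ++ a ∷ []) (sym (axa≈ax a x x↛a)))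
      (trans (≈-congˡ (a ∷ x ∷ []) (aua≈au a u u↛a)) (≈-cong [] u (axa≈ax a x x↛a)))

  aua≈ua : ∀ a u → All (λ x → ¬ Arr a x) u → (a ∷ u ++ a ∷ []) ≈ (u ++ a ∷ [])
  aua≈ua a []      []            = step [] [] (idem a)
  aua≈ua a (x ∷ u) (a↛x ∷ a↛u) =
    trans (≈-congˡ (a ∷ x ∷ []) (sym (aua≈ua a u a↛u)))
      (trans (≈-cong [] (u ++ a ∷ []) (axa≈xa a x a↛x)) (≈-congˡ (x ∷ []) (aua≈ua a u a↛u)))

  ⟶⇒≈HK : ∀ {u v} → u ⇝ v → u ≈ v
  ⟶⇒≈HK (cancelR w₁ w₂ a u u↛a) =
    subst (λ z → (w₁ ++ z) ≈ (w₁ ++ a ∷ u ++ w₂)) (cong (a ∷_) (++-assoc u (a ∷ []) w₂))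
      (≈-cong w₁ w₂ (aua≈au a u u↛a))
  ⟶⇒≈HK (cancelL w₁ w₂ a u a↛u) =
    subst₂ (λ z z′ → (w₁ ++ z) ≈ (w₁ ++ z′)) (cong (a ∷_) (++-assoc u (a ∷ []) w₂)) (++-assoc u (a ∷ []) w₂)
      (≈-cong w₁ w₂ (aua≈ua a u a↛u))

  ⇝*⇒≈HK : ∀ {u v} → u ⇝* v → u ≈ v
  ⇝*⇒≈HK ε              = refl
  ⇝*⇒≈HK (u⇝u′ ◅ u′⇝*v) = trans (⟶⇒≈HK u⇝u′) (⇝*⇒≈HK u′⇝*v)

∼⇒≡ : ∀ {n} (Γ : Graph n) → (∀ a b → ¬ Arrow Γ a b → ¬ Arrow Γ b a → a ≡ b) →
      ∀ {u v} → _∼_ Γ u v → u ≡ v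
∼⇒≡ Γ connected (swap w₁ w₂ a b a↛b b↛a) with connected a b a↛b b↛a
... | refl = refl
∼⇒≡ Γ connected refl            = refl
∼⇒≡ Γ connected (sym v∼u)       = ≡.sym (∼⇒≡ Γ connected v∼u)
∼⇒≡ Γ connected (trans u∼v v∼w) = ≡.trans (∼⇒≡ Γ connected u∼v) (∼⇒≡ Γ connected v∼w)

Γₙ-asymmetric : ∀ n (a b : Fin n) → Arrow (Γₙ n) a b → ¬ Arrow (Γₙ n) b a
Γₙ-asymmetric n a b a→b b→a = <-asym (<ᵇ⇒< (toℕ a) (toℕ b) a→b) (<ᵇ⇒< (toℕ b) (toℕ a) b→a)

Γₙ-connected : ∀ n (a b : Fin n) → ¬ Arrow (Γₙ n) a b → ¬ Arrow (Γₙ n) b a → a ≡ b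
Γₙ-connected n a b a↛b b↛a with <-cmp (toℕ a) (toℕ b)
... | tri< a<b _ _ = ⊥-elim (a↛b (<⇒<ᵇ a<b))
... | tri≈ _ a≡b _ = toℕ-injective a≡b
... | tri> _ _ b<a = ⊥-elim (b↛a (<⇒<ᵇ b<a))

-- Self-loops are irrelevant: only the absence of oriented 2-cycles, proj₂ of simplicity, is used.
mainTheorem4 : ((n : ℕ) (Γ : Graph n) → IsSimpleOriented Γ →
                 (u v : Word Γ) → IsNormalForm Γ u → IsNormalForm Γ v →
                 _≈HK_ Γ u v → _∼_ Γ u v)
               × ((n : ℕ) → (w : Word (Γₙ n)) →
                 (∃[ u ] (IsNormalForm (Γₙ n) u × _≈HK_ (Γₙ n) u w))
                 × ((u v : Word (Γₙ n)) → IsNormalForm (Γₙ n) u → IsNormalForm (Γₙ n) v →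
                    _≈HK_ (Γₙ n) u w → _≈HK_ (Γₙ n) v w → u ≡ v))
mainTheorem4 =
  (λ n Γ simple u v → IsNormalForm-≈HK⇒∼ Γ (proj₂ simple)) ,
  λ n w →
    (nf (Γₙ n) w , nf-isNormalForm (Γₙ n) w , sym (⇝*⇒≈HK (Γₙ n) (⇝*nf (Γₙ n) w))) ,
    λ u v u-normal v-normal u≈w v≈w →
      ∼⇒≡ (Γₙ n) (Γₙ-connected n)
        (IsNormalForm-≈HK⇒∼ (Γₙ n) (Γₙ-asymmetric n) u-normal v-normal (trans u≈w (sym v≈w)))
  where open Cancellation
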